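{- If $p$ is a Mersenne prime (i.e. $p=2^n-1$ for some integer $n$) with $p\equiv\pm 2\pmod 5$, then $(1,1,1)\in\mathcal{C}(p)$.
   Context: For a prime $p$, $\mathcal{X}^*(p)$ is the set of nonzero solutions in $\mathbb{F}_p^3$ of $x_1^2+x_2^2+x_3^2=3x_1x_2x_3$ (it contains $(1,1,1)$). Rotations: $\mathrm{rot}_1(x_1,x_2,x_3)=(x_1,x_3,3x_1x_3-x_2)$, $\mathrm{rot}_2(x_1,x_2,x_3)=(x_3,x_2,3x_2x_3-x_1)$, $\mathrm{rot}_3(x_1,x_2,x_3)=(x_2,3x_2x_3-x_1,x_3)$; $\mathrm{ord}_{p,i}(\mathbf{x})=\min\{n\in\mathbb{Z}_{>0}:\mathrm{rot}_i^n(\mathbf{x})=\mathbf{x}\}$ (equivalently the order of $\begin{pmatrix}0&1\\-1&3x_i\end{pmatrix}$ in $\mathrm{GL}_2(\mathbb{F}_p)$). A point $\mathbf{x}\in\mathcal{X}^*(p)$ is maximal if $\mathrm{ord}_{p,i}(\mathbf{x})\in\{p-1,p+1,2p\}$ for some $i$; the cage $\mathcal{C}(p)$ is the set of all maximal points of $\mathcal{X}^*(p)$. -}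

module Defs where

open import Data.Nat using (ℕ; zero; suc; _+_; _*_; _∸_; _^_; _<_; NonZero)
open import Data.Nat.DivMod using (_%_)
open import Data.Nat.Primality using (Prime; prime⇒nonZero)
open import Data.Fin using (Fin; zero; suc)
open import Data.Product using (_×_; _,_; ∃-syntax)
open import Data.Sum using (_⊎_)
open import Relation.Binary.PropositionalEquality using (_≡_; _≢_)
open import Relation.Nullary using (¬_)

-- Elements of F_p are represented by their canonical residues 0 ≤ a < p
-- (natural numbers); all arithmetic is done modulo p.
-- A point of F_p^3 is a triple of residues.
Point : Set
Point = ℕ × ℕ × ℕ

Reduced : ℕ → Point → Set
Reduced p (a , b , c) = a < p × b < p × c < p

OnMarkoff : (p : ℕ) → .{{NonZero p}} → Point → Set
OnMarkoff p (a , b , c) = (a * a + b * b + c * c) % p ≡ (3 * a * b * c) % p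

InXstar : (p : ℕ) → .{{NonZero p}} → Point → Set
InXstar p x = Reduced p x × OnMarkoff p x × ¬ (x ≡ (0 , 0 , 0))

-- (3 u v - w) mod p, for w a reduced residue
lin : (p : ℕ) → .{{NonZero p}} → ℕ → ℕ → ℕ → ℕ
lin p u v w = (3 * u * v + (p ∸ w)) % p

-- the three rotations, indexed by Fin 3 (zero ↦ rot_1, etc.)
rot : (p : ℕ) → .{{NonZero p}} → Fin 3 → Point → Point
rot p zero          (a , b , c) = (a , c , lin p a c b)
rot p (suc zero)    (a , b , c) = (c , b , lin p b c a)
rot p (suc (suc zero)) (a , b , c) = (b , lin p b c a , c)

iter : {A : Set} → (A → A) → ℕ → A → A
iter f zero    x = x
iter f (suc n) x = f (iter f n x)

IsOrd : (p : ℕ) → .{{NonZero p}} → Fin 3 → Point → ℕ → Set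
IsOrd p i x n =
  0 < n × iter (rot p i) n x ≡ x ×
  (∀ m → 0 < m → m < n → iter (rot p i) m x ≢ x)

Maximal : (p : ℕ) → .{{NonZero p}} → Point → Set
Maximal p x = ∃[ i ] ∃[ n ] (IsOrd p i x n × (n ≡ p ∸ 1 ⊎ n ≡ p + 1 ⊎ n ≡ 2 * p))

InCage : (p : ℕ) → Prime p → Point → Set
InCage p pr x = InXstar p x × Maximal p x
  where instance _ = prime⇒nonZero pr

Mersenne : ℕ → Set
Mersenne p = ∃[ n ] p ≡ 2 ^ n ∸ 1

-- Work in the group ring 𝔽ₚ[C₅] = 𝔽ₚ[ζ]/(ζ⁵ - 1), realised as vectors in ℕ⁵ modulo p on which
-- ζ acts by a cyclic shift, through its semiring of additive endomorphisms. There
-- φ = 1 + ζ + ζ⁻¹ satisfies φ² = φ + 1 up to multiples of 1 + ζ + ⋯ + ζ⁴, so the coefficients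
-- of φⁿ are Fibonacci numbers. In characteristic p the Frobenius x ↦ xᵖ is additive on
-- commuting elements, and p ≡ ±2 (mod 5) makes it send ζ to ζ^(±2), hence φ to its conjugate
-- 1 + ζ² + ζ⁻² = 1 - φ. Comparing coefficients gives F(p) ≡ -1 and F(p+1) ≡ 0 (mod p), so the
-- Fibonacci sequence changes sign after p + 1 steps. The orbit of (1,1,1) under rot₁ is
-- (1, F(2k-1), F(2k+1)); it therefore returns after p + 1 = 2ⁿ steps but not after 2ⁿ⁻¹
-- (that would force F(p) ≡ 1, i.e. p = 2), and a period dividing 2ⁿ but not 2ⁿ⁻¹ is 2ⁿ.
module Submission where

open import Level using (0ℓ; _⊔_)
open import Algebra.Bundles using (Semiring; CommutativeMonoid)
open import Algebra.Core using (Op₂)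
import Algebra.Construct.Pointwise as Pointwise
open import Data.Fin.Base using (Fin; zero; suc)
open import Data.Fin.Patterns using (0F; 1F; 2F; 3F; 4F)
open import Data.Fin.Properties using (toℕ-fromℕ; inject₁ℕ<)
open import Data.Nat.Base as ℕ using (ℕ; zero; suc; NonZero; _<_; z<s; s<s)
import Data.Nat.Properties as ℕ
open import Data.Nat.Combinatorics using (_C_; nC1≡n; nCn≡1; nCk+nC[k+1]≡[n+1]C[k+1])
open import Data.Nat.Coprimality using (Coprime; coprime-divisor)
open import Data.Nat.Divisibility
  using (_∣_; _∣?_; divides; ∣⇒≤; *-cancelʳ-∣; *-monoˡ-∣; ∣-refl; m%n≡0⇒n∣m)
open import Data.Nat.DivMod
  using (_%_; _/_; m≡m%n+[m/n]*n; %-distribˡ-+; %-distribˡ-*; m%n%n≡m%n; m%n≤n; m*n%n≡0; m<n⇒m%n≡m)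
open import Data.Nat.GCD using (gcd; gcd[m,n]∣m; gcd[m,n]∣n; gcd-GCD; module Bézout)
open import Data.Nat.Primality
  using (Prime; euclidsLemma; prime⇒irreducible; prime⇒nonZero; prime⇒nonTrivial; prime[2]; ¬prime[0])
open import Data.Nat.Tactic.RingSolver using (solve-∀)
open import Data.Product using (_,_; ∃-syntax)
open import Data.Sum using (_⊎_; inj₁; inj₂)
open import Data.Vec.Functional using (tail; init; last)
open import Function using (id; _∘_)
open import Relation.Binary.Core using (Rel; _Preserves_⟶_)
open import Relation.Binary.PropositionalEquality as ≡ using (_≡_; _≢_; _≗_; cong; cong₂; subst)
open import Relation.Nullary using (yes; no; contradiction)

open import Defs

[k+1]*[n+1]C[k+1]≡[n+1]*nCk : ∀ n k → suc k ℕ.* (suc n C suc k) ≡ suc n ℕ.* (n C k)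
[k+1]*[n+1]C[k+1]≡[n+1]*nCk zero    zero    = ≡.refl
[k+1]*[n+1]C[k+1]≡[n+1]*nCk zero    (suc k) = ℕ.*-zeroʳ (suc (suc k))
[k+1]*[n+1]C[k+1]≡[n+1]*nCk (suc n) zero    =
  ≡.trans (ℕ.*-identityˡ _) (≡.trans (nC1≡n (suc (suc n))) (≡.sym (ℕ.*-identityʳ _)))
[k+1]*[n+1]C[k+1]≡[n+1]*nCk (suc n) (suc k) = begin
  suc (suc k) * (suc (suc n) C suc (suc k))
    ≡⟨ cong (suc (suc k) *_) (nCk+nC[k+1]≡[n+1]C[k+1] (suc n) (suc k)) ⟨
  suc (suc k) * (a + b)
    ≡⟨ regroup k a b ⟩
  a + (suc k * a + suc (suc k) * b)
    ≡⟨ cong (a +_) (cong₂ _+_ ([k+1]*[n+1]C[k+1]≡[n+1]*nCk n k) ([k+1]*[n+1]C[k+1]≡[n+1]*nCk n (suc k))) ⟩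
  a + (suc n * (n C k) + suc n * (n C suc k))
    ≡⟨ cong (a +_) (*-distribˡ-+ (suc n) (n C k) (n C suc k)) ⟨
  a + suc n * (n C k + n C suc k)
    ≡⟨ cong (λ c → a + suc n * c) (nCk+nC[k+1]≡[n+1]C[k+1] n k) ⟩
  suc (suc n) * a ∎
  where
  open import Data.Nat using (_+_; _*_)
  open import Data.Nat.Properties using (*-distribˡ-+)
  open ≡.≡-Reasoning
  a b : ℕ
  a = suc n C suc k
  b = suc n C suc (suc k)
  regroup : ∀ k a b → suc (suc k) * (a + b) ≡ a + (suc k * a + suc (suc k) * b)
  regroup = solve-∀

prime∣pCk : ∀ {p k} → Prime p → 0 < k → k < p → p ∣ p C k
prime∣pCk {suc n} {suc k} p-prime _ k<p
  with euclidsLemma (suc k) (suc n C suc k) p-prime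
         (divides (n C k) (≡.trans ([k+1]*[n+1]C[k+1]≡[n+1]*nCk n k) (ℕ.*-comm (suc n) (n C k))))
... | inj₁ p∣k = contradiction (∣⇒≤ p∣k) (ℕ.<⇒≱ k<p)
... | inj₂ p∣C = p∣C

module SemiringPowers {c ℓ} (R : Semiring c ℓ) where
  open Semiring R hiding (zero)
  open import Algebra.Properties.Semiring.Mult R using (_×_; ×-congʳ; ×-homo-1; ×-assocˡ; ×-assoc-*)
  open import Algebra.Properties.Semiring.Exp R using (_^_; ^-congˡ; ^-homo-*; ^-assocʳ)
  open import Algebra.Properties.Semiring.Sum R using (sum; sum-init-last; sum-cong-≋; sum-replicate-zero)
  import Algebra.Properties.Semiring.Binomial R as Binomial
  open import Relation.Binary.Reasoning.Setoid setoid

  1#^n≈1# : ∀ n → 1# ^ n ≈ 1#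
  1#^n≈1# zero    = refl
  1#^n≈1# (suc n) = trans (*-identityˡ _) (1#^n≈1# n)

  x^k≈1⇒x^n≈x^[n%k] : ∀ {x k} .{{_ : NonZero k}} → x ^ k ≈ 1# → ∀ n → x ^ n ≈ x ^ (n % k)
  x^k≈1⇒x^n≈x^[n%k] {x} {k} x^k≈1 n = begin
    x ^ n                               ≡⟨ cong (x ^_) (m≡m%n+[m/n]*n n k) ⟩
    x ^ (n % k ℕ.+ n / k ℕ.* k)         ≈⟨ ^-homo-* x (n % k) (n / k ℕ.* k) ⟩
    x ^ (n % k) * x ^ (n / k ℕ.* k)     ≡⟨ cong (λ m → x ^ (n % k) * x ^ m) (ℕ.*-comm (n / k) k) ⟩
    x ^ (n % k) * x ^ (k ℕ.* (n / k))   ≈⟨ *-congˡ (^-assocʳ x k (n / k)) ⟨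
    x ^ (n % k) * (x ^ k) ^ (n / k)     ≈⟨ *-congˡ (trans (^-congˡ (n / k) x^k≈1) (1#^n≈1# (n / k))) ⟩
    x ^ (n % k) * 1#                    ≈⟨ *-identityʳ _ ⟩
    x ^ (n % k)                         ∎

  ∣⇒×≈0# : ∀ {p m} → p × 1# ≈ 0# → ∀ x → p ∣ m → m × x ≈ 0#
  ∣⇒×≈0# {p} char-p x (divides q ≡.refl) = begin
    (q ℕ.* p) × x     ≡⟨ cong (_× x) (ℕ.*-comm q p) ⟩
    (p ℕ.* q) × x     ≈⟨ ×-assocˡ x p q ⟨
    p × (q × x)       ≈⟨ ×-congʳ p (*-identityˡ (q × x)) ⟨
    p × (1# * q × x)  ≈⟨ ×-assoc-* p 1# (q × x) ⟨
    p × 1# * q × x    ≈⟨ *-congʳ char-p ⟩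
    0# * (q × x)      ≈⟨ zeroˡ _ ⟩
    0#                ∎

  [x+y]^p≈x^p+y^p : ∀ {p} → Prime p → p × 1# ≈ 0# →
                    ∀ {x y} → x * y ≈ y * x → (x + y) ^ p ≈ x ^ p + y ^ p
  [x+y]^p≈x^p+y^p {suc q} p-prime char-p {x} {y} x*y≈y*x = begin
    (x + y) ^ suc q                                  ≈⟨ theorem x*y≈y*x (suc q) ⟩
    t zero + sum (tail t)                            ≈⟨ +-congˡ (sum-init-last (tail t)) ⟩
    t zero + (sum (init (tail t)) + last (tail t))   ≈⟨ +-cong first (+-cong middle lst) ⟩
    y ^ suc q + (0# + x ^ suc q)                     ≈⟨ +-congˡ (+-identityˡ _) ⟩
    y ^ suc q + x ^ suc q                            ≈⟨ +-comm _ _ ⟩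
    x ^ suc q + y ^ suc q                            ∎
    where
    open Binomial x y
    t : Fin (suc (suc q)) → Carrier
    t = binomialTerm (suc q)
    first : t zero ≈ y ^ suc q
    first = trans (×-homo-1 _) (*-identityˡ _)
    middle : sum (init (tail t)) ≈ 0#
    middle = trans (sum-cong-≋ middle-term≈0#) (sum-replicate-zero q)
      where
      middle-term≈0# : ∀ i → init (tail t) i ≈ 0#
      middle-term≈0# i = ∣⇒×≈0# char-p _ (prime∣pCk p-prime z<s (s<s (inject₁ℕ< i)))
    lst : last (tail t) ≈ x ^ suc q
    lst rewrite toℕ-fromℕ q | nCn≡1 (suc q) | ℕ.n∸n≡0 q = trans (×-homo-1 _) (*-identityʳ _)

  [1+x+y]^p≈1+x^p+y^p : ∀ {p} → Prime p → p × 1# ≈ 0# →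
                        ∀ {x y} → x * y ≈ y * x → (1# + x + y) ^ p ≈ 1# + x ^ p + y ^ p
  [1+x+y]^p≈1+x^p+y^p {p} p-prime char-p {x} {y} x*y≈y*x = begin
    (1# + x + y) ^ p        ≈⟨ [x+y]^p≈x^p+y^p p-prime char-p [1+x]*y≈y*[1+x] ⟩
    (1# + x) ^ p + y ^ p    ≈⟨ +-congʳ ([x+y]^p≈x^p+y^p p-prime char-p (1*z≈z*1 x)) ⟩
    1# ^ p + x ^ p + y ^ p  ≈⟨ +-congʳ (+-congʳ (1#^n≈1# p)) ⟩
    1# + x ^ p + y ^ p      ∎
    where
    1*z≈z*1 : ∀ z → 1# * z ≈ z * 1#
    1*z≈z*1 z = trans (*-identityˡ z) (sym (*-identityʳ z))
    [1+x]*y≈y*[1+x] : (1# + x) * y ≈ y * (1# + x)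
    [1+x]*y≈y*[1+x] = begin
      (1# + x) * y      ≈⟨ distribʳ y 1# x ⟩
      1# * y + x * y    ≈⟨ +-cong (1*z≈z*1 y) x*y≈y*x ⟩
      y * 1# + y * x    ≈⟨ distribˡ y 1# x ⟨
      y * (1# + x)      ∎

module Endomorphisms {c ℓ} (M : CommutativeMonoid c ℓ) where
  open CommutativeMonoid M renaming (Carrier to A)
  open import Algebra.Properties.CommutativeSemigroup commutativeSemigroup using (interchange)
  open import Algebra.Definitions.RawMonoid rawMonoid using () renaming (_×_ to _×ᴹ_)

  record Endo : Set (c ⊔ ℓ) where
    field
      apply      : A → A
      apply-cong : apply Preserves _≈_ ⟶ _≈_
      apply-∙    : ∀ u v → apply (u ∙ v) ≈ apply u ∙ apply v
      apply-ε    : apply ε ≈ ε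
  open Endo public

  infix  4 _≈ᴱ_
  infixl 6 _+ᴱ_
  infixl 7 _*ᴱ_

  _≈ᴱ_ : Rel Endo (c ⊔ ℓ)
  F ≈ᴱ G = ∀ v → apply F v ≈ apply G v

  _+ᴱ_ : Op₂ Endo
  F +ᴱ G = record
    { apply      = λ v → apply F v ∙ apply G v
    ; apply-cong = λ u≈v → ∙-cong (apply-cong F u≈v) (apply-cong G u≈v)
    ; apply-∙    = λ u v → trans (∙-cong (apply-∙ F u v) (apply-∙ G u v)) (interchange _ _ _ _)
    ; apply-ε    = trans (∙-cong (apply-ε F) (apply-ε G)) (identityˡ ε)
    }

  _*ᴱ_ : Op₂ Endo
  F *ᴱ G = record
    { apply      = apply F ∘ apply G
    ; apply-cong = apply-cong F ∘ apply-cong G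
    ; apply-∙    = λ u v → trans (apply-cong F (apply-∙ G u v)) (apply-∙ F _ _)
    ; apply-ε    = trans (apply-cong F (apply-ε G)) (apply-ε F)
    }

  0ᴱ : Endo
  0ᴱ = record { apply = λ _ → ε ; apply-cong = λ _ → refl ; apply-∙ = λ _ _ → sym (identityˡ ε) ; apply-ε = refl }

  1ᴱ : Endo
  1ᴱ = record { apply = id ; apply-cong = id ; apply-∙ = λ _ _ → refl ; apply-ε = refl }

  semiring : Semiring (c ⊔ ℓ) (c ⊔ ℓ)
  semiring = record
    { Carrier = Endo ; _≈_ = _≈ᴱ_ ; _+_ = _+ᴱ_ ; _*_ = _*ᴱ_ ; 0# = 0ᴱ ; 1# = 1ᴱ
    ; isSemiring = record
      { isSemiringWithoutAnnihilatingZero = record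
        { +-isCommutativeMonoid = record
          { isMonoid = record
            { isSemigroup = record
              { isMagma = record
                { isEquivalence = record
                  { refl = λ _ → refl ; sym = λ F≈G v → sym (F≈G v) ; trans = λ F≈G G≈H v → trans (F≈G v) (G≈H v) }
                ; ∙-cong = λ F≈F′ G≈G′ v → ∙-cong (F≈F′ v) (G≈G′ v)
                }
              ; assoc = λ F G H v → assoc _ _ _
              }
            ; identity = (λ F v → identityˡ _) , (λ F v → identityʳ _)
            }
          ; comm = λ F G v → comm _ _
          }
        ; *-cong     = λ {F} F≈F′ G≈G′ v → trans (apply-cong F (G≈G′ v)) (F≈F′ _)
        ; *-assoc    = λ F G H v → refl
        ; *-identity = (λ F v → refl) , (λ F v → refl)
        ; distrib    = (λ F G H v → apply-∙ F _ _) , (λ F G H v → refl)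
        }
      ; zero = (λ F v → refl) , (λ F v → apply-ε F)
      }
    }

  open import Algebra.Properties.Semiring.Mult semiring using () renaming (_×_ to _×ᴱ_)

  apply-×1ᴱ : ∀ n v → apply (n ×ᴱ 1ᴱ) v ≈ n ×ᴹ v
  apply-×1ᴱ zero    v = refl
  apply-×1ᴱ (suc n) v = ∙-cong refl (apply-×1ᴱ n v)


open import Data.Nat.Base using (_+_; _*_; _∸_; _^_)
open import Data.Nat.Properties
  using (+-assoc; +-comm; +-identityʳ; *-comm; *-identityʳ; *-suc; m+[n∸m]≡n; m^n>0; ≤-<-trans; <⇒≢; even≢odd; ≤-antisym)
open import Data.Product using (_×_)
open import Algebra.Properties.CommutativeSemigroup ℕ.+-commutativeSemigroup using () renaming (interchange to +-interchange)

module Modular (n : ℕ) .{{_ : NonZero n}} where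

  infix 4 _≋_
  _≋_ : Rel ℕ 0ℓ
  a ≋ b = a % n ≡ b % n

  +-cong : ∀ {a b c d} → a ≋ b → c ≋ d → a + c ≋ b + d
  +-cong {a} {b} {c} {d} a≋b c≋d = begin
    (a + c) % n              ≡⟨ %-distribˡ-+ a c n ⟩
    (a % n + c % n) % n      ≡⟨ cong₂ (λ x y → (x + y) % n) a≋b c≋d ⟩
    (b % n + d % n) % n      ≡⟨ %-distribˡ-+ b d n ⟨
    (b + d) % n              ∎
    where open ≡.≡-Reasoning

  *-congˡ : ∀ a {b c} → b ≋ c → a * b ≋ a * c
  *-congˡ a {b} {c} b≋c = begin
    (a * b) % n              ≡⟨ %-distribˡ-* a b n ⟩
    (a % n * (b % n)) % n    ≡⟨ cong (λ x → (a % n * x) % n) b≋c ⟩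
    (a % n * (c % n)) % n    ≡⟨ %-distribˡ-* a c n ⟨
    (a * c) % n              ∎
    where open ≡.≡-Reasoning

  +-0-commutativeMonoid : CommutativeMonoid 0ℓ 0ℓ
  +-0-commutativeMonoid = record
    { Carrier = ℕ ; _≈_ = _≋_ ; _∙_ = _+_ ; ε = 0
    ; isCommutativeMonoid = record
      { isMonoid = record
        { isSemigroup = record
          { isMagma = record
            { isEquivalence = record { refl = ≡.refl ; sym = ≡.sym ; trans = ≡.trans }
            ; ∙-cong = +-cong
            }
          ; assoc = λ a b c → cong (_% n) (+-assoc a b c)
          }
        ; identity = (λ a → ≡.refl) , (λ a → cong (_% n) (+-identityʳ a))
        }
      ; comm = λ a b → cong (_% n) (+-comm a b)
      }
    }

  open CommutativeMonoid +-0-commutativeMonoid public using (setoid)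
  open import Relation.Binary.Reasoning.Setoid setoid

  n*a≋0 : ∀ a → n * a ≋ 0
  n*a≋0 a = ≡.trans (cong (_% n) (*-comm n a)) (≡.trans (m*n%n≡0 a n) (≡.sym (m*n%n≡0 0 n)))

  -- The additive inverse, in the form in which it occurs in `lin`.
  -_ : ℕ → ℕ
  - a = n ∸ a % n

  a%n≋a : ∀ a → a % n ≋ a
  a%n≋a a = m%n%n≡m%n a n

  +-inverseʳ : ∀ a → a + - a ≋ 0
  +-inverseʳ a = begin
    a + (n ∸ a % n)        ≈⟨ +-cong (a%n≋a a) ≡.refl ⟨
    a % n + (n ∸ a % n)    ≡⟨ m+[n∸m]≡n (m%n≤n a n) ⟩
    n                      ≡⟨ *-identityʳ n ⟨
    n * 1                  ≈⟨ n*a≋0 1 ⟩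
    0                      ∎

  b≋c+a⇒b-a≋c : ∀ {a b c} → b ≋ c + a → b + - a ≋ c
  b≋c+a⇒b-a≋c {a} {b} {c} b≋c+a = begin
    b + - a            ≈⟨ +-cong b≋c+a ≡.refl ⟩
    c + a + - a        ≡⟨ +-assoc c a (- a) ⟩
    c + (a + - a)      ≈⟨ +-cong {c} ≡.refl (+-inverseʳ a) ⟩
    c + 0              ≡⟨ +-identityʳ c ⟩
    c                  ∎

  a≋0⇒n∣a : ∀ {a} → a ≋ 0 → n ∣ a
  a≋0⇒n∣a {a} a≋0 = m%n≡0⇒n∣m a n (≡.trans a≋0 (m*n%n≡0 0 n))

  +-cancelʳ : ∀ {a b} c → a + c ≋ b + c → a ≋ b
  +-cancelʳ {a} {b} c a+c≋b+c = begin
    a                  ≈⟨ b≋c+a⇒b-a≋c ≡.refl ⟨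
    a + c + - c        ≈⟨ +-cong a+c≋b+c ≡.refl ⟩
    b + c + - c        ≈⟨ b≋c+a⇒b-a≋c ≡.refl ⟩
    b                  ∎

∣p^[1+k]⇒∣p^k : ∀ {p d} k → Prime p → d ∣ p ^ suc k → d ≢ p ^ suc k → d ∣ p ^ k
∣p^[1+k]⇒∣p^k {p} {d} zero p-prime d∣p d≢p
  with prime⇒irreducible p-prime (subst (d ∣_) (*-identityʳ p) d∣p)
... | inj₁ ≡.refl = ∣-refl
... | inj₂ d≡p    = contradiction (≡.trans d≡p (≡.sym (*-identityʳ p))) d≢p
∣p^[1+k]⇒∣p^k {p} {d} (suc k) p-prime d∣p^k+2 d≢p^k+2 with p ∣? d
... | no p∤d = coprime-divisor d⊥p d∣p^k+2
  where
  d⊥p : Coprime d p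
  d⊥p (i∣d , i∣p) with prime⇒irreducible p-prime i∣p
  ... | inj₁ i≡1    = i≡1
  ... | inj₂ ≡.refl = contradiction i∣d p∤d
... | yes (divides e ≡.refl) =
  subst (e * p ∣_) (*-comm (p ^ k) p) (*-monoˡ-∣ p (∣p^[1+k]⇒∣p^k k p-prime e∣p^k+1 e≢p^k+1))
  where
  instance _ = prime⇒nonZero p-prime
  e∣p^k+1 : e ∣ p ^ suc k
  e∣p^k+1 = *-cancelʳ-∣ p (subst (e * p ∣_) (*-comm p (p ^ suc k)) d∣p^k+2)
  e≢p^k+1 : e ≢ p ^ suc k
  e≢p^k+1 e≡p^k+1 = d≢p^k+2 (≡.trans (cong (_* p) e≡p^k+1) (*-comm (p ^ suc k) p))

module _ {A : Set} (g : A → A) where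

  iter-+ : ∀ m n x → iter g (m + n) x ≡ iter g m (iter g n x)
  iter-+ zero    n x = ≡.refl
  iter-+ (suc m) n x = cong g (iter-+ m n x)

  iter-fix-* : ∀ {x n} → iter g n x ≡ x → ∀ c → iter g (c * n) x ≡ x
  iter-fix-* gⁿx≡x zero    = ≡.refl
  iter-fix-* {x} {n} gⁿx≡x (suc c) = begin
    iter g (n + c * n) x         ≡⟨ iter-+ n (c * n) x ⟩
    iter g n (iter g (c * n) x)  ≡⟨ cong (iter g n) (iter-fix-* gⁿx≡x c) ⟩
    iter g n x                   ≡⟨ gⁿx≡x ⟩
    x                            ∎
    where open ≡.≡-Reasoning

  iter-fix-∣ : ∀ {x m n} → m ∣ n → iter g m x ≡ x → iter g n x ≡ x
  iter-fix-∣ (divides c ≡.refl) gᵐx≡x = iter-fix-* gᵐx≡x c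

  iter-fix-cancelʳ : ∀ {x} m n → iter g (m + n) x ≡ x → iter g n x ≡ x → iter g m x ≡ x
  iter-fix-cancelʳ {x} m n gᵐ⁺ⁿx≡x gⁿx≡x = begin
    iter g m x               ≡⟨ cong (iter g m) gⁿx≡x ⟨
    iter g m (iter g n x)    ≡⟨ iter-+ m n x ⟨
    iter g (m + n) x         ≡⟨ gᵐ⁺ⁿx≡x ⟩
    x                        ∎
    where open ≡.≡-Reasoning

  iter-fix-gcd : ∀ {x m n} → iter g m x ≡ x → iter g n x ≡ x → iter g (gcd m n) x ≡ x
  iter-fix-gcd {x} {m} {n} gᵐx≡x gⁿx≡x with Bézout.identity (gcd-GCD m n)
  ... | Bézout.+- a b d+bn≡am = iter-fix-cancelʳ (gcd m n) (b * n)
          (subst (λ k → iter g k x ≡ x) (≡.sym d+bn≡am) (iter-fix-* gᵐx≡x a)) (iter-fix-* gⁿx≡x b)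
  ... | Bézout.-+ a b d+am≡bn = iter-fix-cancelʳ (gcd m n) (a * m)
          (subst (λ k → iter g k x ≡ x) (≡.sym d+am≡bn) (iter-fix-* gⁿx≡x b)) (iter-fix-* gᵐx≡x a)

  prime-power-period : ∀ {x p} k → Prime p → iter g (p ^ suc k) x ≡ x → iter g (p ^ k) x ≢ x →
                       ∀ m → 0 < m → m < p ^ suc k → iter g m x ≢ x
  prime-power-period {x} {p} k p-prime gᴺx≡x gᴺ′x≢x m@(suc _) _ m<pᴺ gᵐx≡x =
    gᴺ′x≢x (iter-fix-∣ d∣p^k (iter-fix-gcd {m = m} {n = p ^ suc k} gᵐx≡x gᴺx≡x))
    where
    d : ℕ
    d = gcd m (p ^ suc k)
    d∣p^k : d ∣ p ^ k
    d∣p^k = ∣p^[1+k]⇒∣p^k k p-prime (gcd[m,n]∣n m (p ^ suc k))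
              (<⇒≢ (≤-<-trans (∣⇒≤ (gcd[m,n]∣m m (p ^ suc k))) m<pᴺ))

-- fib₋₁ n is the Fibonacci number F(n - 1), with F(-1) = 1.
fib₋₁ : ℕ → ℕ
fib₋₁ 0             = 1
fib₋₁ 1             = 0
fib₋₁ (suc (suc n)) = fib₋₁ n + fib₋₁ (suc n)

fib₋₁[4+n]+fib₋₁[n]≡3*fib₋₁[2+n] : ∀ n → fib₋₁ (4 + n) + fib₋₁ n ≡ 3 * fib₋₁ (2 + n)
fib₋₁[4+n]+fib₋₁[n]≡3*fib₋₁[2+n] n = unfold (fib₋₁ n) (fib₋₁ (suc n))
  where
  unfold : ∀ x y → (x + y) + (y + (x + y)) + x ≡ 3 * (x + y)
  unfold = solve-∀

module _ (m : ℕ) .{{_ : NonZero m}} where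
  open Modular m
  open import Relation.Binary.Reasoning.Setoid setoid

  fib₋₁-antiperiodic : ∀ {k} → fib₋₁ k + 1 ≋ 0 → fib₋₁ (suc k) ≋ 0 → ∀ n → fib₋₁ (n + k) + fib₋₁ n ≋ 0
  fib₋₁-antiperiodic F[k]≋-1 F[k+1]≋0 0 = F[k]≋-1
  fib₋₁-antiperiodic {k} F[k]≋-1 F[k+1]≋0 1 = ≡.trans (cong (_% m) (+-identityʳ (fib₋₁ (suc k)))) F[k+1]≋0
  fib₋₁-antiperiodic {k} F[k]≋-1 F[k+1]≋0 (suc (suc n)) = begin
    (a + b) + (c + d)    ≡⟨ +-interchange a b c d ⟩
    (a + c) + (b + d)    ≈⟨ +-cong (fib₋₁-antiperiodic F[k]≋-1 F[k+1]≋0 n) (fib₋₁-antiperiodic F[k]≋-1 F[k+1]≋0 (suc n)) ⟩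
    0                    ∎
    where
    a b c d : ℕ
    a = fib₋₁ (n + k)
    b = fib₋₁ (suc n + k)
    c = fib₋₁ n
    d = fib₋₁ (suc n)

  fib₋₁-periodic : ∀ {k} → fib₋₁ k + 1 ≋ 0 → fib₋₁ (suc k) ≋ 0 → ∀ n → fib₋₁ (n + 2 * k) ≋ fib₋₁ n
  fib₋₁-periodic {k} F[k]≋-1 F[k+1]≋0 n = begin
    fib₋₁ (n + 2 * k)                                    ≡⟨ cong fib₋₁ (regroup n k) ⟩
    fib₋₁ (n + k + k)                                    ≡⟨ +-identityʳ _ ⟨
    fib₋₁ (n + k + k) + 0                                ≈⟨ +-cong {fib₋₁ (n + k + k)} ≡.refl (antiperiodic n) ⟨
    fib₋₁ (n + k + k) + (fib₋₁ (n + k) + fib₋₁ n)       ≡⟨ +-assoc (fib₋₁ (n + k + k)) _ _ ⟨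
    fib₋₁ (n + k + k) + fib₋₁ (n + k) + fib₋₁ n         ≈⟨ +-cong (antiperiodic (n + k)) ≡.refl ⟩
    fib₋₁ n                                              ∎
    where
    antiperiodic : ∀ n → fib₋₁ (n + k) + fib₋₁ n ≋ 0
    antiperiodic = fib₋₁-antiperiodic F[k]≋-1 F[k+1]≋0
    regroup : ∀ n k → n + 2 * k ≡ n + k + k
    regroup = solve-∀

rotate rotate⁻¹ : Fin 5 → Fin 5
rotate 0F = 1F
rotate 1F = 2F
rotate 2F = 3F
rotate 3F = 4F
rotate 4F = 0F
rotate⁻¹ 0F = 4F
rotate⁻¹ 1F = 0F
rotate⁻¹ 2F = 1F
rotate⁻¹ 3F = 2F
rotate⁻¹ 4F = 3F

-- ℤₚ[C₅] holds coefficient vectors of 𝔽ₚ[ζ]/(ζ⁵ - 1); σ and τ multiply by ζ and ζ⁻¹.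
module GoldenRatio (p : ℕ) .{{_ : NonZero p}} where
  open Modular p

  ℤₚ[C₅] : CommutativeMonoid 0ℓ 0ℓ
  ℤₚ[C₅] = Pointwise.commutativeMonoid (Fin 5) +-0-commutativeMonoid

  open CommutativeMonoid ℤₚ[C₅] using (rawMonoid) renaming (_≈_ to _≈ᵥ_)
  open import Algebra.Definitions.RawMonoid rawMonoid using () renaming (_×_ to _×ᵥ_)
  open Endomorphisms ℤₚ[C₅]
  open import Algebra.Properties.Semiring.Exp semiring using () renaming (_^_ to _^ᴱ_)
  open import Algebra.Properties.Semiring.Mult semiring using () renaming (_×_ to _×ᴱ_)
  open SemiringPowers semiring using ([1+x+y]^p≈1+x^p+y^p; x^k≈1⇒x^n≈x^[n%k])

  shift : (Fin 5 → Fin 5) → Endo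
  shift π = record
    { apply = λ v → v ∘ π ; apply-cong = λ v≈w → v≈w ∘ π ; apply-∙ = λ _ _ _ → ≡.refl ; apply-ε = λ _ → ≡.refl }

  σ τ φ : Endo
  σ = shift rotate⁻¹
  τ = shift rotate
  φ = 1ᴱ +ᴱ σ +ᴱ τ

  σ⁵≈1ᴱ : σ ^ᴱ 5 ≈ᴱ 1ᴱ
  σ⁵≈1ᴱ v = λ { 0F → ≡.refl ; 1F → ≡.refl ; 2F → ≡.refl ; 3F → ≡.refl ; 4F → ≡.refl }

  τ⁵≈1ᴱ : τ ^ᴱ 5 ≈ᴱ 1ᴱ
  τ⁵≈1ᴱ v = λ { 0F → ≡.refl ; 1F → ≡.refl ; 2F → ≡.refl ; 3F → ≡.refl ; 4F → ≡.refl }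

  στ≈τσ : σ *ᴱ τ ≈ᴱ τ *ᴱ σ
  στ≈τσ v = λ { 0F → ≡.refl ; 1F → ≡.refl ; 2F → ≡.refl ; 3F → ≡.refl ; 4F → ≡.refl }

  p×1ᴱ≈0ᴱ : p ×ᴱ 1ᴱ ≈ᴱ 0ᴱ
  p×1ᴱ≈0ᴱ v i = ≡.trans (apply-×1ᴱ p v i) (≡.trans (cong (_% p) (×ᵥ-pointwise p i)) (n*a≋0 (v i)))
    where
    ×ᵥ-pointwise : ∀ n i → (n ×ᵥ v) i ≡ n * v i
    ×ᵥ-pointwise zero    i = ≡.refl
    ×ᵥ-pointwise (suc n) i = cong (v i +_) (×ᵥ-pointwise n i)

  φ^p≈1+σ^r+τ^r : Prime p → φ ^ᴱ p ≈ᴱ 1ᴱ +ᴱ σ ^ᴱ (p % 5) +ᴱ τ ^ᴱ (p % 5)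
  φ^p≈1+σ^r+τ^r p-prime v i = ≡.trans ([1+x+y]^p≈1+x^p+y^p p-prime p×1ᴱ≈0ᴱ {σ} {τ} στ≈τσ v i)
                       (+-cong (+-cong {v i} ≡.refl (σ^p≈σ^r v i)) (τ^p≈τ^r v i))
    where
    σ^p≈σ^r : σ ^ᴱ p ≈ᴱ σ ^ᴱ (p % 5)
    σ^p≈σ^r = x^k≈1⇒x^n≈x^[n%k] {σ} {5} σ⁵≈1ᴱ p
    τ^p≈τ^r : τ ^ᴱ p ≈ᴱ τ ^ᴱ (p % 5)
    τ^p≈τ^r = x^k≈1⇒x^n≈x^[n%k] {τ} {5} τ⁵≈1ᴱ p

  e₀ : Fin 5 → ℕ
  e₀ 0F = 1
  e₀ _  = 0

  -- a + b (ζ + ζ⁻¹) + g (1 + ζ + ζ² + ζ³ + ζ⁴)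
  fibVector : ℕ → ℕ → ℕ → Fin 5 → ℕ
  fibVector a b g 0F = a + g
  fibVector a b g 1F = b + g
  fibVector a b g 2F = g
  fibVector a b g 3F = g
  fibVector a b g 4F = b + g

  φ-fibVector : ∀ a b g → apply φ (fibVector a b g) ≗ fibVector (b + a) a (g + (b + g) + g)
  φ-fibVector a b g 0F = coefficient₀ a b g
    where
    coefficient₀ : ∀ a b g → a + g + (b + g) + (b + g) ≡ b + a + (g + (b + g) + g)
    coefficient₀ = solve-∀
  φ-fibVector a b g 1F = coefficient₁ a b g
    where
    coefficient₁ : ∀ a b g → b + g + (a + g) + g ≡ a + (g + (b + g) + g)
    coefficient₁ = solve-∀
  φ-fibVector a b g 2F = ≡.refl
  φ-fibVector a b g 3F = coefficient₃ b g
    where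
    coefficient₃ : ∀ b g → g + g + (b + g) ≡ g + (b + g) + g
    coefficient₃ = solve-∀
  φ-fibVector a b g 4F = coefficient₄ a b g
    where
    coefficient₄ : ∀ a b g → b + g + g + (a + g) ≡ a + (g + (b + g) + g)
    coefficient₄ = solve-∀

  φⁿe₀ : ∀ n → ∃[ g ] apply (φ ^ᴱ n) e₀ ≈ᵥ fibVector (fib₋₁ (2 + n)) (fib₋₁ (1 + n)) g
  φⁿe₀ zero = 0 , λ { 0F → ≡.refl ; 1F → ≡.refl ; 2F → ≡.refl ; 3F → ≡.refl ; 4F → ≡.refl }
  φⁿe₀ (suc n) with φⁿe₀ n
  ... | g , φⁿe₀≈ = _ , λ i → ≡.trans (apply-cong φ φⁿe₀≈ i) (cong (_% p) (φ-fibVector _ _ g i))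

  -- 1 + ζ² + ζ⁻², the conjugate of φ
  φ̄ : Fin 5 → ℕ
  φ̄ 0F = 1
  φ̄ 1F = 0
  φ̄ 2F = 1
  φ̄ 3F = 1
  φ̄ 4F = 0

  conjugate : p % 5 ≡ 2 ⊎ p % 5 ≡ 3 → apply (1ᴱ +ᴱ σ ^ᴱ (p % 5) +ᴱ τ ^ᴱ (p % 5)) e₀ ≗ φ̄
  conjugate (inj₁ p%5≡2) rewrite p%5≡2 = λ { 0F → ≡.refl ; 1F → ≡.refl ; 2F → ≡.refl ; 3F → ≡.refl ; 4F → ≡.refl }
  conjugate (inj₂ p%5≡3) rewrite p%5≡3 = λ { 0F → ≡.refl ; 1F → ≡.refl ; 2F → ≡.refl ; 3F → ≡.refl ; 4F → ≡.refl }

  φᵖe₀≈φ̄ : Prime p → p % 5 ≡ 2 ⊎ p % 5 ≡ 3 →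
           ∃[ g ] ∀ i → fibVector (fib₋₁ (2 + p)) (fib₋₁ (1 + p)) g i ≋ φ̄ i
  φᵖe₀≈φ̄ p-prime p%5 with φⁿe₀ p
  ... | g , φᵖe₀≈ = g , λ i →
    ≡.trans (≡.sym (φᵖe₀≈ i)) (≡.trans (φ^p≈1+σ^r+τ^r p-prime e₀ i) (cong (_% p) (conjugate p%5 i)))

  fib₋₁[1+p]+1≋0 : Prime p → p % 5 ≡ 2 ⊎ p % 5 ≡ 3 → fib₋₁ (1 + p) + 1 ≋ 0
  fib₋₁[1+p]+1≋0 p-prime p%5 with φᵖe₀≈φ̄ p-prime p%5
  ... | g , coefficient = ≡.trans (+-cong {fib₋₁ (1 + p)} ≡.refl (≡.sym (coefficient 2F))) (coefficient 1F)

  fib₋₁[2+p]≋0 : Prime p → p % 5 ≡ 2 ⊎ p % 5 ≡ 3 → fib₋₁ (2 + p) ≋ 0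
  fib₋₁[2+p]≋0 p-prime p%5 with φᵖe₀≈φ̄ p-prime p%5
  ... | g , coefficient = +-cancelʳ g (≡.trans (coefficient 0F) (≡.sym (coefficient 2F)))

module Orbit (p : ℕ) .{{_ : NonZero p}} (1<p : 1 < p) where
  open Modular p

  1%p≡1 : 1 % p ≡ 1
  1%p≡1 = m<n⇒m%n≡m 1<p

  x₀ : Point
  x₀ = 1 , 1 , 1

  R : Point → Point
  R = rot p 0F

  lin-fib₋₁ : ∀ n → lin p 1 (fib₋₁ (2 + n) % p) (fib₋₁ n % p) ≡ fib₋₁ (4 + n) % p
  lin-fib₋₁ n = b≋c+a⇒b-a≋c (begin
    3 * (fib₋₁ (2 + n) % p)    ≈⟨ *-congˡ 3 (a%n≋a (fib₋₁ (2 + n))) ⟩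
    3 * fib₋₁ (2 + n)          ≡⟨ fib₋₁[4+n]+fib₋₁[n]≡3*fib₋₁[2+n] n ⟨
    fib₋₁ (4 + n) + fib₋₁ n    ∎)
    where open import Relation.Binary.Reasoning.Setoid setoid

  orbit : ∀ k → iter R k x₀ ≡ (1 , fib₋₁ (2 * k) % p , fib₋₁ (2 + 2 * k) % p)
  orbit zero    = cong (λ r → 1 , r , r) (≡.sym 1%p≡1)
  orbit (suc k) = begin
    R (iter R k x₀)
      ≡⟨ cong R (orbit k) ⟩
    (1 , fib₋₁ (2 + 2 * k) % p , lin p 1 (fib₋₁ (2 + 2 * k) % p) (fib₋₁ (2 * k) % p))
      ≡⟨ cong (λ c → 1 , fib₋₁ (2 + 2 * k) % p , c) (lin-fib₋₁ (2 * k)) ⟩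
    (1 , fib₋₁ (2 + 2 * k) % p , fib₋₁ (4 + 2 * k) % p)
      ≡⟨ cong (λ j → 1 , fib₋₁ j % p , fib₋₁ (2 + j) % p) (*-suc 2 k) ⟨
    (1 , fib₋₁ (2 * suc k) % p , fib₋₁ (2 + 2 * suc k) % p) ∎
    where open ≡.≡-Reasoning

  module Period (F[p]≋-1 : fib₋₁ (1 + p) + 1 ≋ 0) (F[p+1]≋0 : fib₋₁ (2 + p) ≋ 0) where

    orbit-period : iter R (1 + p) x₀ ≡ x₀
    orbit-period = ≡.trans (orbit (1 + p))
      (cong₂ (λ b c → 1 , b , c) (≡.trans (periodic 0) 1%p≡1) (≡.trans (periodic 2) 1%p≡1))
      where
      periodic : ∀ n → fib₋₁ (n + 2 * (1 + p)) ≋ fib₋₁ n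
      periodic = fib₋₁-periodic p F[p]≋-1 F[p+1]≋0

    orbit-not-half-period : ∀ K → 1 + p ≡ 2 * K → iter R K x₀ ≢ x₀
    orbit-not-half-period K 1+p≡2K Rᴷx₀≡x₀ = even≢odd K 1 (≡.trans (≡.sym 1+p≡2K) (cong suc p≡2))
      where
      F[p]≋1 : fib₋₁ (1 + p) ≋ 1
      F[p]≋1 = begin
        fib₋₁ (1 + p)      ≡⟨ cong fib₋₁ 1+p≡2K ⟩
        fib₋₁ (2 * K)      ≈⟨ ≡.trans (cong (λ { (_ , b , _) → b }) (≡.trans (≡.sym (orbit K)) Rᴷx₀≡x₀)) (≡.sym 1%p≡1) ⟩
        1                  ∎
        where open import Relation.Binary.Reasoning.Setoid setoid
      p∣2 : p ∣ 2
      p∣2 = a≋0⇒n∣a (≡.trans (≡.sym (+-cong F[p]≋1 (≡.refl {x = 1 % p}))) F[p]≋-1)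
      p≡2 : p ≡ 2
      p≡2 = ≤-antisym (∣⇒≤ p∣2) 1<p

mersenne-exponent : ∀ {p} → Prime p → Mersenne p → ∃[ N ] 1 + p ≡ 2 ^ suc N
mersenne-exponent p-prime (zero  , ≡.refl) = contradiction p-prime ¬prime[0]
mersenne-exponent p-prime (suc N , ≡.refl) = N , m+[n∸m]≡n (m^n>0 2 (suc N))

corollary4p3 : (p : ℕ) (pr : Prime p) → Mersenne p →
    (p % 5 ≡ 2 ⊎ p % 5 ≡ 3) →
    InCage p pr (1 , 1 , 1)
corollary4p3 p pr mersenne p%5 with mersenne-exponent pr mersenne
... | N , 1+p≡2^[1+N] =
  ((1<p , 1<p , 1<p) , ≡.refl , λ ()) , 0F , 1 + p , (z<s , orbit-period , minimal) , inj₂ (inj₁ (+-comm 1 p))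
  where
  instance _ = prime⇒nonZero pr
  1<p : 1 < p
  1<p = ℕ.nonTrivial⇒n>1 p {{prime⇒nonTrivial pr}}
  open Orbit p 1<p
  open Period (GoldenRatio.fib₋₁[1+p]+1≋0 p pr p%5) (GoldenRatio.fib₋₁[2+p]≋0 p pr p%5)
  minimal : ∀ m → 0 < m → m < 1 + p → iter R m x₀ ≢ x₀
  minimal m 0<m m<1+p = prime-power-period R N prime[2]
    (subst (λ n → iter R n x₀ ≡ x₀) 1+p≡2^[1+N] orbit-period)
    (orbit-not-half-period (2 ^ N) 1+p≡2^[1+N]) m 0<m (subst (m <_) 1+p≡2^[1+N] m<1+p)
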